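{- $\vDash_{\mathsf{PI}}\Diamond\exists x\in\mathbb{N}\,(x=0\wedge\Box\forall y(y=0\rightarrow y=x))$.
   Context: PI model: $\mathcal{M}=\langle W,R,D,I\rangle$ with $W$ countably infinite, $R$ a directed partial order, each $D(w)$ non-empty finite, $n$-ary second-order quantifiers at $w$ range over all subsets of $D(w)^n$, $D(w)\subsetneq D(s)$ whenever $R(w,s)$, $w\ne s$, and an injection $\mathbf{a}:\omega\to\bigcup_wD(w)$ with $\#X=\mathbf{a}_{|X|}$ at every world for all $X\subseteq D(s)$, $s\in W$. Kripke semantics: actualist first-order quantifiers over $D(w)$, free variables may denote any object of the model, rigid set variables, $\Box$ over $R$-successors. $\vDash_{\mathsf{PI}}\varphi$: true at every world of every PI model. Definitions: $0:=\#\varnothing$; $Sxy:\equiv\Diamond\exists G\exists u[Gu\wedge y=\#G\wedge x=\#(G\setminus\{u\})]$; $S^+(a,b):\equiv\forall X[(\forall x,y(Xx\wedge Sxy\rightarrow Xy)\wedge\forall x(Sax\rightarrow Xx))\rightarrow Xb]$; $S^{+=}(a,b):\equiv S^+(a,b)\vee a=b$; $\mathbb{N}x:\equiv S^{+=}(0,x)\wedge\exists y(y=0)$; $\exists x\in\mathbb{N}\,\varphi$ abbreviates $\exists x(\mathbb{N}x\wedge\varphi)$. -}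

module Defs where

open import Data.Nat using (ℕ; zero; suc; _≥_)
open import Data.Fin using (Fin)
open import Data.Fin.Subset using (Subset; _∈_; _-_; ∣_∣; ⊥)
open import Data.Product using (Σ; _×_; _,_; ∃)
open import Data.Sum using (_⊎_)
open import Relation.Nullary using (¬_)
open import Relation.Binary.PropositionalEquality using (_≡_; _≢_)
open import Relation.Binary.Structures using (IsPartialOrder)
open import Function.Bundles using (_↔_)
open import Function.Definitions using (Injective)

-- The (finite, non-empty) domain
-- D(w) is given as an injective enumeration  elem w : Fin (size w) → Obj,
-- so subsets of D(w) are exactly  Subset (size w)  and |X| is  ∣ X ∣.
record PIModel : Set₁ where
  field
    W        : Set
    W-count  : W ↔ ℕ
    R        : W → W → Set
    R-po     : IsPartialOrder _≡_ R
    R-dir    : ∀ w v → Σ W λ u → R w u × R v u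
    Obj      : Set
    size     : W → ℕ
    size≥1   : ∀ w → size w ≥ 1
    elem     : (w : W) → Fin (size w) → Obj
    elem-inj : ∀ w → Injective _≡_ _≡_ (elem w)
    -- D(w) ⊊ D(s) whenever R(w,s), w ≠ s
    D-sub    : ∀ w s → R w s → w ≢ s →
               ∀ (i : Fin (size w)) → Σ (Fin (size s)) λ j → elem s j ≡ elem w i
    D-new    : ∀ w s → R w s → w ≢ s →
               Σ (Fin (size s)) λ j → ∀ (i : Fin (size w)) → elem s j ≢ elem w i
    -- the injection a : ω → ⋃_w D(w); #X is interpreted as a_|X|
    a        : ℕ → Obj
    a-inj    : Injective _≡_ _≡_ a
    a-in     : ∀ k → Σ W λ w → Σ (Fin (size w)) λ i → elem w i ≡ a k

module _ (M : PIModel) where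
  open PIModel M

  #_ : {w : W} → Subset (size w) → Obj
  #_ X = a ∣ X ∣

  -- 0 := #∅  (the empty set, taken as a subset of D(w) for any w; |∅| = 0)
  𝟎 : Obj
  𝟎 = a 0

  _∈[_]_ : Obj → (w : W) → Subset (size w) → Set
  x ∈[ w ] X = Σ (Fin (size w)) λ i → elem w i ≡ x × i ∈ X

  Succ : W → Obj → Obj → Set
  Succ w x y = Σ W λ s → R w s × Σ (Subset (size s)) λ G → Σ (Fin (size s)) λ u →
               u ∈ G × y ≡ # G × x ≡ # (G - u)

  S⁺ : W → Obj → Obj → Set
  S⁺ w b c = (X : Subset (size w)) →
     ((i j : Fin (size w)) → elem w i ∈[ w ] X → Succ w (elem w i) (elem w j) → elem w j ∈[ w ] X) →
     ((i : Fin (size w)) → Succ w b (elem w i) → elem w i ∈[ w ] X) →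
     c ∈[ w ] X

  S⁺⁼ : W → Obj → Obj → Set
  S⁺⁼ w b c = S⁺ w b c ⊎ b ≡ c

  IsNat : W → Obj → Set
  IsNat w x = S⁺⁼ w 𝟎 x × Σ (Fin (size w)) λ j → elem w j ≡ 𝟎

  Lemma13Formula : W → Set
  Lemma13Formula w =
    Σ W λ s → R w s × Σ (Fin (size s)) λ i →
      IsNat s (elem s i) × elem s i ≡ 𝟎 ×
      ((t : W) → R s t → (j : Fin (size t)) → elem t j ≡ 𝟎 → elem t j ≡ elem s i)

-- The object 0 = a₀ lies in some domain D(v).  By directedness some world u sees
-- both w and v, and domains grow along R, so 0 ∈ D(u); at u the object 0 is itself
-- a number (S⁺⁼(0,0) holds by reflexivity) and every later y = 0 is that same object.
module Submission where

open import Defs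
open import Data.Fin using (Fin)
open import Data.Nat using (_≟_)
open import Data.Product using (Σ; _×_; _,_)
open import Data.Sum using (inj₂)
open import Function.Bundles using (Inverse; Injection)
open import Function.Properties.Inverse using (Inverse⇒Injection)
open import Relation.Binary.Definitions using (DecidableEquality)
open import Relation.Binary.PropositionalEquality using (_≡_; refl; sym; trans; cong)
open import Relation.Nullary using (yes; no)
open import Relation.Nullary.Decidable using (map′)

module _ (M : PIModel) where
  open PIModel M

  _∈D_ : Obj → W → Set
  x ∈D w = Σ (Fin (size w)) λ i → elem w i ≡ x

  _≟W_ : DecidableEquality W
  w ≟W v = map′ (Injection.injective (Inverse⇒Injection W-count))
                (cong (Inverse.to W-count)) (Inverse.to W-count w ≟ Inverse.to W-count v)

  -- D-sub only covers v ≢ u; the case split needs W ≅ ℕ for decidable equality.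
  ∈D-mono : ∀ {x v u} → R v u → x ∈D v → x ∈D u
  ∈D-mono {v = v} {u} Rvu (i , eᵢ) with v ≟W u
  ... | yes refl = i , eᵢ
  ... | no v≢u   = let (j , eⱼ) = D-sub v u Rvu v≢u i in j , trans eⱼ eᵢ

  𝟎-∈D-eventually : ∀ w → Σ W λ u → R w u × 𝟎 M ∈D u
  𝟎-∈D-eventually w =
    let (v , i , eᵢ) = a-in 0
        (u , Rwu , Rvu) = R-dir w v
    in u , Rwu , ∈D-mono Rvu (i , eᵢ)

  ≡𝟎⇒IsNat : ∀ {s x} → x ≡ 𝟎 M → x ∈D s → IsNat M s x
  ≡𝟎⇒IsNat refl x∈D = inj₂ refl , x∈D

lemma13 : (M : PIModel) (w : PIModel.W M) → Lemma13Formula M w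
lemma13 M w =
  let (u , Rwu , i , eᵢ) = 𝟎-∈D-eventually M w
  in u , Rwu , i , ≡𝟎⇒IsNat M eᵢ (i , refl) , eᵢ , λ _ _ _ eⱼ → trans eⱼ (sym eᵢ)
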